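{- Let $d$ be an integer greater than $1$. Then $d \leq \beta^d(d+1) \leq d+1$. Moreover, $\beta^{d}(d+1) = d+1$ when $d$ is even.
   Context: Two vectors $A,B\in\mathbb{R}^n$ are trivially orthogonal if for every coordinate $i\in[n]$ at least one of $A(i)$, $B(i)$ is zero; they are non-trivially orthogonal if they are orthogonal (inner product $0$) but not trivially orthogonal. For $2\le d\le n$, the trivial points of $\{0,1\}^n$ are the all-zero vector and the $n$ unit vectors, together with the all-ones vector when $d$ is odd. $\beta^d(n)$ is the minimum cardinality of a set $\mathcal{V}$ of vectors in $\{ -1,0,1\}^n$, each having exactly $d$ non-zero entries, such that every non-trivial point $A\in\{0,1\}^n$ has some $V\in\mathcal{V}$ non-trivially orthogonal to $A$. Here $n=d+1$. -}

module Defs where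

open import Data.Nat using (ℕ; zero; suc; _≤_; _%_)
open import Data.Integer using (ℤ; 0ℤ; 1ℤ; -1ℤ; _+_; _*_)
open import Data.Fin using (Fin; zero; suc)
open import Data.List using (List; length)
open import Data.List.Relation.Unary.All using (All)
open import Data.Product using (Σ; ∃; _×_)
open import Data.Sum using (_⊎_)
open import Relation.Binary.PropositionalEquality using (_≡_; _≢_)
open import Relation.Nullary using (¬_; Dec; yes; no)
open import Data.Integer.Properties using () renaming (_≟_ to _≟ℤ_)

Vecℤ : ℕ → Set
Vecℤ n = Fin n → ℤ

dot : ∀ {n} → Vecℤ n → Vecℤ n → ℤ
dot {zero}  A B = 0ℤ
dot {suc n} A B = A zero * B zero + dot (λ i → A (suc i)) (λ i → B (suc i))

nnz : ∀ {n} → Vecℤ n → ℕ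
nnz {zero}  A = zero
nnz {suc n} A with A zero ≟ℤ 0ℤ
... | yes _ = nnz (λ i → A (suc i))
... | no  _ = suc (nnz (λ i → A (suc i)))

Signed : ∀ {n} → Vecℤ n → Set
Signed A = ∀ i → (A i ≡ -1ℤ) ⊎ (A i ≡ 0ℤ) ⊎ (A i ≡ 1ℤ)

Binary : ∀ {n} → Vecℤ n → Set
Binary A = ∀ i → (A i ≡ 0ℤ) ⊎ (A i ≡ 1ℤ)

TriviallyOrthogonal : ∀ {n} → Vecℤ n → Vecℤ n → Set
TriviallyOrthogonal A B = ∀ i → (A i ≡ 0ℤ) ⊎ (B i ≡ 0ℤ)

NonTriviallyOrthogonal : ∀ {n} → Vecℤ n → Vecℤ n → Set
NonTriviallyOrthogonal A B = (dot A B ≡ 0ℤ) × ¬ TriviallyOrthogonal A B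

unit : ∀ {n} → Fin n → Vecℤ n
unit j i with Data.Fin._≟_ i j
... | yes _ = 1ℤ
... | no  _ = 0ℤ

zeroVec : ∀ {n} → Vecℤ n
zeroVec _ = 0ℤ

onesVec : ∀ {n} → Vecℤ n
onesVec _ = 1ℤ

Trivial : (d : ℕ) → ∀ {n} → Vecℤ n → Set
Trivial d A =
  (∀ i → A i ≡ zeroVec i)
  ⊎ (∃ λ j → ∀ i → A i ≡ unit j i)
  ⊎ ((d % 2 ≡ 1) × (∀ i → A i ≡ onesVec i))

IsCover : (d n : ℕ) → List (Vecℤ n) → Set
IsCover d n 𝒱 =
  All (λ V → Signed V × (nnz V ≡ d)) 𝒱
  × (∀ (A : Vecℤ n) → Binary A → ¬ Trivial d A →
       Data.List.Relation.Unary.Any.Any (λ V → NonTriviallyOrthogonal V A) 𝒱)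
  where import Data.List.Relation.Unary.Any

IsBeta : (d n m : ℕ) → Set
IsBeta d n m =
  (Σ (List (Vecℤ n)) λ 𝒱 → IsCover d n 𝒱 × (length 𝒱 ≡ m))
  × (∀ 𝒱 → IsCover d n 𝒱 → m ≤ length 𝒱)

-- Write F A t = Σ_{i<t} (-1)^i A i for the alternating partial sums of A ∈ {0,1}^{k+1}, k even.
-- The vector W_t = (1, -1, 1, ...) with a 0 inserted at position t satisfies
-- W_t · A = F A t + F A (t+1) - F A (k+1). As a function of t this moves in steps of size at most 1,
-- and its values at t = 0 and t = k add up to A₀ - A_k ∈ {-1, 0, 1}, so it vanishes somewhere:
-- the k + 1 vectors W_t cover the even case d = k. For odd d = k + 1 the vectors ((-1)^t, W_t)
-- handle A = (0, A′) the same way; for A = (1, A′) one needs W_t · A′ = -(-1)^t, which holds where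
-- F A′ arrives at half its total (if even), or where F (A′ - 1) departs from half of its own.
--
-- For the lower bounds, a member V non-trivially orthogonal to 1 - e_w has Σ V = V_w, while Σ V has
-- the parity of its support size d. For even d this forces V_w = 0; as every member has exactly one
-- zero, the d + 1 coordinates need distinct members. For odd d the test vectors 1 - e_w - e_u force
-- V_w = 0 or V_u = 0, and choosing u to be no member's zero (if there is one) leaves d coordinates
-- needing distinct members.

module Submission where

open import Defs
open import Data.Nat as ℕ using (ℕ; zero; suc; z≤n; s≤s; _≤_; _<_; _%_)
import Data.Nat.Properties as ℕP
open import Data.Integer as ℤ using (ℤ; +_; -[1+_]; 0ℤ; 1ℤ; -1ℤ; _+_; _*_; -_; _-_; -≤+; +≤+)
import Data.Integer.Properties as ℤP
open import Data.Integer.DivMod using (_%ℕ_; _/ℕ_; n%ℕd<d; a≡a%ℕn+[a/ℕn]*n)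
open import Data.Integer.Tactic.RingSolver using (solve-∀)
open import Data.Fin as Fin using (Fin; zero; suc; toℕ; fromℕ; fromℕ<; punchIn)
import Data.Fin.Properties as FinP
open import Data.Vec.Functional using (head; tail; _∷_)
open import Data.List using (List; length; tabulate; lookup)
import Data.List.Properties as ListP
open import Data.List.Relation.Unary.All as All using (All)
import Data.List.Relation.Unary.All.Properties as AllP
open import Data.List.Relation.Unary.Any as Any using (Any; here; there; index)
import Data.List.Relation.Unary.Any.Properties as AnyP
open import Data.Product as Product using (∃; _×_; _,_)
open import Data.Sum as Sum using (_⊎_; inj₁; inj₂; [_,_]′)
open import Function using (_∘_; id)
open import Function.Definitions using (Injective)
open import Relation.Nullary using (¬_; Dec; yes; no; contradiction)
open import Relation.Nullary.Decidable using (¬?; decidable-stable; _⊎-dec_)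
open import Relation.Unary using (Decidable)
open import Relation.Binary.PropositionalEquality
  using (_≡_; _≢_; refl; sym; trans; cong; cong₂; subst; module ≡-Reasoning)

Trit : ℤ → Set
Trit δ = (δ ≡ -1ℤ) ⊎ (δ ≡ 0ℤ) ⊎ (δ ≡ 1ℤ)

trit-neg : ∀ {δ} → Trit δ → Trit (- δ)
trit-neg (inj₁ refl)        = inj₂ (inj₂ refl)
trit-neg (inj₂ (inj₁ refl)) = inj₂ (inj₁ refl)
trit-neg (inj₂ (inj₂ refl)) = inj₁ refl

Bit : ℤ → Set
Bit a = (a ≡ 0ℤ) ⊎ (a ≡ 1ℤ)

bit⇒trit : ∀ {a} → Bit a → Trit a
bit⇒trit (inj₁ a≡0) = inj₂ (inj₁ a≡0)
bit⇒trit (inj₂ a≡1) = inj₂ (inj₂ a≡1)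

bit-difference : ∀ {a b} → Bit a → Bit b → Trit (a - b)
bit-difference (inj₁ refl) (inj₁ refl) = inj₂ (inj₁ refl)
bit-difference (inj₁ refl) (inj₂ refl) = inj₁ refl
bit-difference (inj₂ refl) (inj₁ refl) = inj₂ (inj₂ refl)
bit-difference (inj₂ refl) (inj₂ refl) = inj₂ (inj₁ refl)

binary⇒signed : ∀ {n} {A : Vecℤ n} → Binary A → Signed A
binary⇒signed bin i = bit⇒trit (bin i)

IsSign : ℤ → Set
IsSign x = x ≡ -1ℤ ⊎ x ≡ 1ℤ

isSign-neg : ∀ {s} → IsSign s → IsSign (- s)
isSign-neg (inj₁ refl) = inj₂ refl
isSign-neg (inj₂ refl) = inj₁ refl

isSign⇒trit : ∀ {s} → IsSign s → Trit s
isSign⇒trit (inj₁ s≡-1) = inj₁ s≡-1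
isSign⇒trit (inj₂ s≡1)  = inj₂ (inj₂ s≡1)

trit⇒0⊎isSign : ∀ {x} → Trit x → x ≡ 0ℤ ⊎ IsSign x
trit⇒0⊎isSign (inj₁ x≡-1)        = inj₂ (inj₁ x≡-1)
trit⇒0⊎isSign (inj₂ (inj₁ x≡0)) = inj₁ x≡0
trit⇒0⊎isSign (inj₂ (inj₂ x≡1)) = inj₂ (inj₂ x≡1)

sign : ℕ → ℤ
sign zero    = 1ℤ
sign (suc t) = - sign t

sign-isSign : ∀ t → IsSign (sign t)
sign-isSign zero = inj₂ refl
sign-isSign (suc t) with sign-isSign t
... | inj₁ s≡-1 = inj₂ (cong -_ s≡-1)
... | inj₂ s≡1  = inj₁ (cong -_ s≡1)

isSign⇒≢0 : ∀ {x} → IsSign x → x ≢ 0ℤ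
isSign⇒≢0 (inj₁ refl) ()
isSign⇒≢0 (inj₂ refl) ()

sign≢0 : ∀ t → sign t ≢ 0ℤ
sign≢0 t = isSign⇒≢0 (sign-isSign t)

sign-double : ∀ m → sign (m ℕ.+ m) ≡ 1ℤ
sign-double zero = refl
sign-double (suc m) rewrite ℕP.+-suc m m =
  trans (ℤP.neg-involutive (sign (m ℕ.+ m))) (sign-double m)

odd-%2 : ∀ m → suc (m ℕ.+ m) % 2 ≡ 1
odd-%2 zero = refl
odd-%2 (suc m) rewrite ℕP.+-suc m m = odd-%2 m

halve : ∀ z → ∃ λ κ → (z ≡ κ + κ) ⊎ (z ≡ 1ℤ + (κ + κ))
halve z with z %ℕ 2 | n%ℕd<d z 2 | a≡a%ℕn+[a/ℕn]*n z 2
... | 0           | _            | z≡r+2q = z /ℕ 2 , inj₁ (trans z≡r+2q (double (z /ℕ 2)))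
  where
  double : ∀ q → + 0 + q * + 2 ≡ q + q
  double = solve-∀
... | 1           | _            | z≡r+2q = z /ℕ 2 , inj₂ (trans z≡r+2q (double (z /ℕ 2)))
  where
  double : ∀ q → + 1 + q * + 2 ≡ 1ℤ + (q + q)
  double = solve-∀
... | suc (suc _) | s≤s (s≤s ()) | _

1+double≢0 : ∀ y → 1ℤ + (y + y) ≢ 0ℤ
1+double≢0 (+ n)    ()
1+double≢0 -[1+ n ] ()

odd≢even : ∀ i j → 1ℤ + (i + i) ≢ j + j
odd≢even i j odd≡even = 1+double≢0 (i - j) (begin
  1ℤ + ((i - j) + (i - j))     ≡⟨ regroup i j ⟩
  (1ℤ + (i + i)) - (j + j)     ≡⟨ ℤP.i≡j⇒i-j≡0 odd≡even ⟩
  0ℤ                           ∎)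
  where
  open ≡-Reasoning
  regroup : ∀ i j → 1ℤ + ((i - j) + (i - j)) ≡ (1ℤ + (i + i)) - (j + j)
  regroup = solve-∀

isSign-odd : ∀ {x} → IsSign x → ∃ λ i → x ≡ 1ℤ + (i + i)
isSign-odd (inj₁ refl) = -1ℤ , refl
isSign-odd (inj₂ refl) = 0ℤ , refl

trit-even⇒0 : ∀ {x j} → Trit x → x ≡ j + j → x ≡ 0ℤ
trit-even⇒0 {j = j} x-trit x≡2j with trit⇒0⊎isSign x-trit
... | inj₁ x≡0 = x≡0
... | inj₂ x±1 with isSign-odd x±1
...   | i , x≡1+2i = contradiction (trans (sym x≡1+2i) x≡2j) (odd≢even i j)

trit-sum-odd⇒0 : ∀ {x y j} → Trit x → Trit y → x + y ≡ 1ℤ + (j + j) → x ≡ 0ℤ ⊎ y ≡ 0ℤ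
trit-sum-odd⇒0 {x} {y} {j} x-trit y-trit x+y≡odd
  with trit⇒0⊎isSign x-trit | trit⇒0⊎isSign y-trit
... | inj₁ x≡0 | _        = inj₁ x≡0
... | inj₂ _   | inj₁ y≡0 = inj₂ y≡0
... | inj₂ x±1 | inj₂ y±1 with isSign-odd x±1 | isSign-odd y±1
...   | a , x≡1+2a | b , y≡1+2b = contradiction (begin
  1ℤ + (j + j)                      ≡⟨ sym x+y≡odd ⟩
  x + y                             ≡⟨ cong₂ _+_ x≡1+2a y≡1+2b ⟩
  (1ℤ + (a + a)) + (1ℤ + (b + b))   ≡⟨ regroup a b ⟩
  (1ℤ + a + b) + (1ℤ + a + b)       ∎) (odd≢even j (1ℤ + a + b))
  where
  open ≡-Reasoning
  regroup : ∀ a b → (1ℤ + (a + a)) + (1ℤ + (b + b)) ≡ (1ℤ + a + b) + (1ℤ + a + b)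
  regroup = solve-∀

-- Inner products, unit vectors and supports

dot-cong : ∀ {n} {A A′ B B′ : Vecℤ n} →
           (∀ i → A i ≡ A′ i) → (∀ i → B i ≡ B′ i) → dot A B ≡ dot A′ B′
dot-cong {zero}  _   _   = refl
dot-cong {suc n} A≗A′ B≗B′ =
  cong₂ _+_ (cong₂ _*_ (A≗A′ zero) (B≗B′ zero)) (dot-cong (A≗A′ ∘ suc) (B≗B′ ∘ suc))

dot-zeroʳ : ∀ {n} (V : Vecℤ n) → dot V zeroVec ≡ 0ℤ
dot-zeroʳ {zero}  V = refl
dot-zeroʳ {suc n} V rewrite dot-zeroʳ (tail V) | ℤP.*-zeroʳ (head V) = refl

dot-minusʳ : ∀ {n} (V B C : Vecℤ n) → dot V (λ i → B i - C i) ≡ dot V B - dot V C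
dot-minusʳ {zero}  V B C = refl
dot-minusʳ {suc n} V B C rewrite dot-minusʳ (tail V) (tail B) (tail C) =
  distrib (head V) (head B) (head C) (dot (tail V) (tail B)) (dot (tail V) (tail C))
  where
  distrib : ∀ v b c x y → v * (b - c) + (x - y) ≡ (v * b + x) - (v * c + y)
  distrib = solve-∀

dot-onesVec-onesVec : ∀ n → dot {n} onesVec onesVec ≡ + n
dot-onesVec-onesVec zero = refl
dot-onesVec-onesVec (suc n) rewrite dot-onesVec-onesVec n = refl

unit-diagonal : ∀ {n} (j : Fin n) → unit j j ≡ 1ℤ
unit-diagonal j with j Fin.≟ j
... | yes _   = refl
... | no j≢j = contradiction refl j≢j

unit-off-diagonal : ∀ {n} {i j : Fin n} → i ≢ j → unit j i ≡ 0ℤ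
unit-off-diagonal {i = i} {j} i≢j with i Fin.≟ j
... | yes i≡j = contradiction i≡j i≢j
... | no _    = refl

unit-binary : ∀ {n} (j : Fin n) → Binary (unit j)
unit-binary j i with i Fin.≟ j
... | yes _ = inj₂ refl
... | no _  = inj₁ refl

unit-suc : ∀ {n} (j i : Fin n) → unit (suc j) (suc i) ≡ unit j i
unit-suc j i = by-cases (i Fin.≟ j)
  where
  by-cases : Dec (i ≡ j) → unit (suc j) (suc i) ≡ unit j i
  by-cases (yes refl) = trans (unit-diagonal (suc j)) (sym (unit-diagonal j))
  by-cases (no i≢j)   =
    trans (unit-off-diagonal (i≢j ∘ FinP.suc-injective)) (sym (unit-off-diagonal i≢j))

dot-unitʳ : ∀ {n} (V : Vecℤ n) (w : Fin n) → dot V (unit w) ≡ V w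
dot-unitʳ {suc n} V zero = begin
  head V * unit {suc n} zero zero + dot (tail V) (λ i → unit zero (suc i))
    ≡⟨ cong₂ (λ x y → head V * x + y) (unit-diagonal {suc n} zero)
             (trans (dot-cong (λ _ → refl)
                              (λ i → unit-off-diagonal {suc n} {i = suc i} {j = zero} λ ()))
                    (dot-zeroʳ (tail V))) ⟩
  head V * 1ℤ + 0ℤ
    ≡⟨ trans (ℤP.+-identityʳ _) (ℤP.*-identityʳ _) ⟩
  head V ∎
  where open ≡-Reasoning
dot-unitʳ {suc n} V (suc w) = begin
  head V * unit (suc w) zero + dot (tail V) (λ i → unit (suc w) (suc i))
    ≡⟨ cong₂ (λ x y → head V * x + y) (unit-off-diagonal {suc n} {i = zero} {j = suc w} λ ())
             (trans (dot-cong (λ _ → refl) (λ i → unit-suc w i)) (dot-unitʳ (tail V) w)) ⟩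
  head V * 0ℤ + V (suc w)
    ≡⟨ trans (cong (_+ V (suc w)) (ℤP.*-zeroʳ (head V))) (ℤP.+-identityˡ _) ⟩
  V (suc w) ∎
  where open ≡-Reasoning

nnz-head-nonzero : ∀ {n} (V : Vecℤ (suc n)) → head V ≢ 0ℤ → nnz V ≡ suc (nnz (tail V))
nnz-head-nonzero V V₀≢0 with head V ℤP.≟ 0ℤ
... | yes V₀≡0 = contradiction V₀≡0 V₀≢0
... | no _     = refl

nnz-head-zero : ∀ {n} (V : Vecℤ (suc n)) → head V ≡ 0ℤ → nnz V ≡ nnz (tail V)
nnz-head-zero V V₀≡0 with head V ℤP.≟ 0ℤ
... | yes _    = refl
... | no V₀≢0 = contradiction V₀≡0 V₀≢0

nnz≤ : ∀ {n} (V : Vecℤ n) → nnz V ≤ n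
nnz≤ {zero}  V = z≤n
nnz≤ {suc n} V with head V ℤP.≟ 0ℤ
... | yes _ = ℕP.m≤n⇒m≤1+n (nnz≤ (tail V))
... | no _  = s≤s (nnz≤ (tail V))

nnz<-zero : ∀ {n} (V : Vecℤ n) w → V w ≡ 0ℤ → nnz V < n
nnz<-zero {suc n} V zero    V₀≡0 rewrite nnz-head-zero V V₀≡0 = s≤s (nnz≤ (tail V))
nnz<-zero {suc n} V (suc w) Vw≡0 with head V ℤP.≟ 0ℤ
... | yes _ = ℕP.m≤n⇒m≤1+n (nnz<-zero (tail V) w Vw≡0)
... | no _  = s≤s (nnz<-zero (tail V) w Vw≡0)

nnz+2≤-two-zeros : ∀ {n} (V : Vecℤ n) {w w′} → w ≢ w′ → V w ≡ 0ℤ → V w′ ≡ 0ℤ →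
                   suc (suc (nnz V)) ≤ n
nnz+2≤-two-zeros {suc n} V {zero}  {zero}   w≢w′ _ _ = contradiction refl w≢w′
nnz+2≤-two-zeros {suc n} V {zero}  {suc w′} _ V₀≡0 Vw′≡0
  rewrite nnz-head-zero V V₀≡0 = s≤s (nnz<-zero (tail V) w′ Vw′≡0)
nnz+2≤-two-zeros {suc n} V {suc w} {zero}   _ Vw≡0 V₀≡0
  rewrite nnz-head-zero V V₀≡0 = s≤s (nnz<-zero (tail V) w Vw≡0)
nnz+2≤-two-zeros {suc n} V {suc w} {suc w′} w≢w′ Vw≡0 Vw′≡0 with head V ℤP.≟ 0ℤ
... | yes _ = ℕP.m≤n⇒m≤1+n (nnz+2≤-two-zeros (tail V) (w≢w′ ∘ cong suc) Vw≡0 Vw′≡0)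
... | no _  = s≤s (nnz+2≤-two-zeros (tail V) (w≢w′ ∘ cong suc) Vw≡0 Vw′≡0)

zero-unique : ∀ {d} (V : Vecℤ (suc d)) → nnz V ≡ d → ∀ {w w′} → V w ≡ 0ℤ → V w′ ≡ 0ℤ → w ≡ w′
zero-unique {d} V nnz≡d {w} {w′} Vw≡0 Vw′≡0 with w Fin.≟ w′
... | yes w≡w′ = w≡w′
... | no w≢w′  = contradiction (subst (λ k → suc (suc k) ≤ suc d) nnz≡d
                                  (nnz+2≤-two-zeros V w≢w′ Vw≡0 Vw′≡0)) ℕP.1+n≰n

signed-sum-parity : ∀ {n} (V : Vecℤ n) → Signed V → ∃ λ j → dot V onesVec ≡ + nnz V + (j + j)
signed-sum-parity {zero}  V signed = 0ℤ , refl
signed-sum-parity {suc n} V signed with signed-sum-parity (tail V) (signed ∘ suc) | signed zero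
... | j , sum≡ | inj₁ V₀≡-1 rewrite nnz-head-nonzero V (isSign⇒≢0 (inj₁ V₀≡-1)) | sum≡ | V₀≡-1 =
  j - 1ℤ , regroup (+ nnz (tail V)) j
  where
  regroup : ∀ x j → -1ℤ * 1ℤ + (x + (j + j)) ≡ (1ℤ + x) + ((j - 1ℤ) + (j - 1ℤ))
  regroup = solve-∀
... | j , sum≡ | inj₂ (inj₁ V₀≡0) rewrite nnz-head-zero V V₀≡0 | sum≡ | V₀≡0 =
  j , ℤP.+-identityˡ _
... | j , sum≡ | inj₂ (inj₂ V₀≡1) rewrite nnz-head-nonzero V (isSign⇒≢0 (inj₂ V₀≡1)) | sum≡ | V₀≡1 =
  j , regroup (+ nnz (tail V)) j
  where
  regroup : ∀ x j → 1ℤ * 1ℤ + (x + (j + j)) ≡ (1ℤ + x) + (j + j)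
  regroup = solve-∀

¬trivially-orthogonal : ∀ {n} {V A : Vecℤ n} i → V i ≢ 0ℤ → A i ≡ 1ℤ → ¬ TriviallyOrthogonal V A
¬trivially-orthogonal i Vᵢ≢0 Aᵢ≡1 trivially with trivially i
... | inj₁ Vᵢ≡0 = Vᵢ≢0 Vᵢ≡0
... | inj₂ Aᵢ≡0 = isSign⇒≢0 (inj₂ refl) (trans (sym Aᵢ≡1) Aᵢ≡0)

supported-at⇒trivial : ∀ {n} d {A : Vecℤ n} p → Binary A → (∀ i → i ≡ p ⊎ A i ≡ 0ℤ) → Trivial d A
supported-at⇒trivial d {A} p binary supported with binary p
... | inj₁ Aₚ≡0 = inj₁ λ i → [ (λ { refl → Aₚ≡0 }) , (λ Aᵢ≡0 → Aᵢ≡0) ]′ (supported i)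
... | inj₂ Aₚ≡1 = inj₂ (inj₁ (p , λ i → is-unit i (supported i) (i Fin.≟ p)))
  where
  is-unit : ∀ i → i ≡ p ⊎ A i ≡ 0ℤ → Dec (i ≡ p) → A i ≡ unit p i
  is-unit i _              (yes refl) = trans Aₚ≡1 (sym (unit-diagonal p))
  is-unit i (inj₁ i≡p)     (no i≢p)   = contradiction i≡p i≢p
  is-unit i (inj₂ Aᵢ≡0)    (no i≢p)   = trans Aᵢ≡0 (sym (unit-off-diagonal i≢p))

nontrivial⇒one-elsewhere : ∀ {n} d {A : Vecℤ n} → Binary A → ¬ Trivial d A →
                           (p : Fin n) → ∃ λ i → i ≢ p × A i ≡ 1ℤ
nontrivial⇒one-elsewhere {n} d {A} binary nontrivial p
  with FinP.all? (λ i → (i Fin.≟ p) ⊎-dec (A i ℤP.≟ 0ℤ))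
... | yes supported = contradiction (supported-at⇒trivial d p binary supported) nontrivial
... | no unsupported with FinP.¬∀⟶∃¬ n _ (λ i → (i Fin.≟ p) ⊎-dec (A i ℤP.≟ 0ℤ)) unsupported
...   | i , ¬[i≡p⊎Aᵢ≡0] with binary i
...     | inj₁ Aᵢ≡0 = contradiction (inj₂ Aᵢ≡0) ¬[i≡p⊎Aᵢ≡0]
...     | inj₂ Aᵢ≡1 = i , ¬[i≡p⊎Aᵢ≡0] ∘ inj₁ , Aᵢ≡1

binary-not-ones⇒zero : ∀ {n} {A : Vecℤ n} → Binary A → ¬ (∀ i → A i ≡ 1ℤ) → ∃ λ i → A i ≡ 0ℤ
binary-not-ones⇒zero {n} {A} binary not-ones
  with FinP.¬∀⟶∃¬ n _ (λ i → A i ℤP.≟ 1ℤ) not-ones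
... | i , Aᵢ≢1 = i , [ (λ Aᵢ≡0 → Aᵢ≡0) , (λ Aᵢ≡1 → contradiction Aᵢ≡1 Aᵢ≢1) ]′ (binary i)

trivial⇒total : ∀ {n} d {A : Vecℤ n} → Trivial d A →
                dot onesVec A ≡ 0ℤ ⊎ dot onesVec A ≡ 1ℤ ⊎ dot onesVec A ≡ + n
trivial⇒total {n} d (inj₁ A≡0) = inj₁ (trans (dot-cong (λ _ → refl) A≡0) (dot-zeroʳ {n} onesVec))
trivial⇒total {n} d (inj₂ (inj₁ (j , A≡eⱼ))) =
  inj₂ (inj₁ (trans (dot-cong (λ _ → refl) A≡eⱼ) (dot-unitʳ onesVec j)))
trivial⇒total {n} d (inj₂ (inj₂ (_ , A≡1))) =
  inj₂ (inj₂ (trans (dot-cong (λ _ → refl) A≡1) (dot-onesVec-onesVec n)))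

¬trivial-by-total : ∀ {n} d {A : Vecℤ n} {x} → dot onesVec A ≡ x →
                    x ≢ 0ℤ → x ≢ 1ℤ → x ≢ + n → ¬ Trivial d A
¬trivial-by-total d total≡x x≢0 x≢1 x≢n trivial with trivial⇒total d trivial
... | inj₁ total≡0        = x≢0 (trans (sym total≡x) total≡0)
... | inj₂ (inj₁ total≡1) = x≢1 (trans (sym total≡x) total≡1)
... | inj₂ (inj₂ total≡n) = x≢n (trans (sym total≡x) total≡n)

-- Integer sequences with steps in {-1, 0, 1}

UnitSteps : (ℕ → ℤ) → Set
UnitSteps h = ∀ t → ∃ λ δ → Trit δ × h (suc t) ≡ h t + δ

Moves : (ℕ → ℤ) → ℕ → Set
Moves h m = ∃ λ i → i < m × h (suc i) ≢ h i

unitSteps-neg : ∀ {h} → UnitSteps h → UnitSteps (-_ ∘ h)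
unitSteps-neg {h} steps t with steps t
... | δ , δ-trit , step =
  - δ , trit-neg δ-trit , trans (cong -_ step) (ℤP.neg-distrib-+ (h t) δ)

unitSteps-shift : ∀ {f} κ → UnitSteps f → UnitSteps (λ t → f t - κ)
unitSteps-shift {f} κ steps t with steps t
... | δ , δ-trit , step rewrite step = δ , δ-trit , regroup (f t) δ κ
  where
  regroup : ∀ x δ κ → x + δ - κ ≡ (x - κ) + δ
  regroup = solve-∀

negative+trit≤0 : ∀ {x δ} → x ℤ.< 0ℤ → Trit δ → x + δ ℤ.≤ 0ℤ
negative+trit≤0 {+ n}         (ℤ.+<+ ()) _
negative+trit≤0 { -[1+ m ]}    _ (inj₁ refl)        = -≤+
negative+trit≤0 { -[1+ m ]}    _ (inj₂ (inj₁ refl)) rewrite ℤP.+-identityʳ -[1+ m ] = -≤+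
negative+trit≤0 { -[1+ zero ]} _ (inj₂ (inj₂ refl)) = +≤+ z≤n
negative+trit≤0 { -[1+ suc m ]} _ (inj₂ (inj₂ refl)) = -≤+

root-between : ∀ h → UnitSteps h → ∀ m → h 0 ℤ.≤ 0ℤ → 0ℤ ℤ.≤ h m → ∃ λ t → t ≤ m × h t ≡ 0ℤ
root-between h steps zero    h₀≤0 0≤h₀ = 0 , z≤n , ℤP.≤-antisym h₀≤0 0≤h₀
root-between h steps (suc m) h₀≤0 0≤hₘ with h 0 ℤP.≟ 0ℤ
... | yes h₀≡0 = 0 , z≤n , h₀≡0
... | no h₀≢0 with steps 0
... | δ , δ-trit , step
  with root-between (h ∘ suc) (steps ∘ suc) m
         (subst (ℤ._≤ 0ℤ) (sym step) (negative+trit≤0 (ℤP.≤∧≢⇒< h₀≤0 h₀≢0) δ-trit)) 0≤hₘ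
... | t , t≤m , hₜ≡0 = suc t , s≤s t≤m , hₜ≡0

trit-sum⇒opposite-signs : ∀ x y → Trit (x + y) →
  (x ℤ.≤ 0ℤ × 0ℤ ℤ.≤ y) ⊎ (0ℤ ℤ.≤ x × y ℤ.≤ 0ℤ)
trit-sum⇒opposite-signs (+ zero)  (+ n)     _ = inj₁ (+≤+ z≤n , +≤+ z≤n)
trit-sum⇒opposite-signs (+ zero)  -[1+ n ]  _ = inj₂ (+≤+ z≤n , -≤+)
trit-sum⇒opposite-signs (+ suc a) (+ zero)  _ = inj₂ (+≤+ z≤n , +≤+ z≤n)
trit-sum⇒opposite-signs (+ suc a) -[1+ n ]  _ = inj₂ (+≤+ z≤n , -≤+)
trit-sum⇒opposite-signs (+ suc a) (+ suc b) (inj₁ ())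
trit-sum⇒opposite-signs (+ suc a) (+ suc b) (inj₂ (inj₁ ()))
trit-sum⇒opposite-signs (+ suc a) (+ suc b) (inj₂ (inj₂ a+b+2≡1)) =
  contradiction (ℕP.suc-injective (ℤP.+-injective a+b+2≡1)) (ℕP.m+1+n≢0 a)
trit-sum⇒opposite-signs -[1+ a ]  (+ n)     _ = inj₁ (-≤+ , +≤+ z≤n)
trit-sum⇒opposite-signs -[1+ a ]  -[1+ b ]  (inj₁ ())
trit-sum⇒opposite-signs -[1+ a ]  -[1+ b ]  (inj₂ (inj₁ ()))
trit-sum⇒opposite-signs -[1+ a ]  -[1+ b ]  (inj₂ (inj₂ ()))

root-of-trit-sum : ∀ h → UnitSteps h → ∀ m → Trit (h 0 + h m) → ∃ λ t → t ≤ m × h t ≡ 0ℤ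
root-of-trit-sum h steps m sum-trit with trit-sum⇒opposite-signs (h 0) (h m) sum-trit
... | inj₁ (h₀≤0 , 0≤hₘ) = root-between h steps m h₀≤0 0≤hₘ
... | inj₂ (0≤h₀ , hₘ≤0) with root-between (-_ ∘ h) (unitSteps-neg {h} steps) m
                                (ℤP.neg-mono-≤ 0≤h₀) (ℤP.neg-mono-≤ hₘ≤0)
...   | t , t≤m , -hₜ≡0 = t , t≤m , trans (sym (ℤP.neg-involutive (h t))) (cong -_ -hₜ≡0)

crossing : ∀ {P : ℕ → Set} → Decidable P → ∀ {j k} → j ≤ k → P j → ¬ P k →
           ∃ λ t → t < k × P t × ¬ P (suc t)
crossing P? {zero} {zero} z≤n Pj ¬Pk = contradiction Pj ¬Pk
crossing {P} P? {j} {suc k} j≤1+k Pj ¬P1+k with P? k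
... | yes Pk = k , ℕP.n<1+n k , Pk , ¬P1+k
... | no ¬Pk with crossing P? (ℕ.s≤s⁻¹ (ℕP.≤∧≢⇒< j≤1+k λ { refl → ¬P1+k Pj })) Pj ¬Pk
...   | t , t<k , Pt , ¬P1+t = t , ℕP.m<n⇒m<1+n t<k , Pt , ¬P1+t

nonzero-near-step : ∀ (h : ℕ → ℤ) {i} → h (suc i) ≢ h i → ∃ λ j → j ≤ suc i × h j ≢ 0ℤ
nonzero-near-step h {i} moves with h i ℤP.≟ 0ℤ
... | no hᵢ≢0  = i , ℕP.n≤1+n i , hᵢ≢0
... | yes hᵢ≡0 = suc i , ℕP.≤-refl , λ hᵢ₊₁≡0 → moves (trans hᵢ₊₁≡0 (sym hᵢ≡0))

fin-witness : ∀ {m t} {Q : ℕ → Set} → t < m → Q t → ∃ λ (i : Fin m) → Q (toℕ i)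
fin-witness {Q = Q} t<m Qt = fromℕ< t<m , subst Q (sym (FinP.toℕ-fromℕ< t<m)) Qt

arrival-between : ∀ (h : ℕ → ℤ) {j k} → j ≤ k → h j ≢ 0ℤ → h k ≡ 0ℤ →
                  ∃ λ t → t < k × h t ≢ 0ℤ × h (suc t) ≡ 0ℤ
arrival-between h j≤k hⱼ≢0 hₖ≡0
  with crossing {λ t → h t ≢ 0ℤ} (λ t → ¬? (h t ℤP.≟ 0ℤ)) j≤k hⱼ≢0 (λ hₖ≢0 → hₖ≢0 hₖ≡0)
... | t , t<k , hₜ≢0 , ¬hₜ₊₁≢0 = t , t<k , hₜ≢0 , decidable-stable (h (suc t) ℤP.≟ 0ℤ) ¬hₜ₊₁≢0

departure-between : ∀ (h : ℕ → ℤ) {j k} → j ≤ k → h j ≡ 0ℤ → h k ≢ 0ℤ →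
                    ∃ λ t → t < k × h t ≡ 0ℤ × h (suc t) ≢ 0ℤ
departure-between h = crossing {λ t → h t ≡ 0ℤ} (λ t → h t ℤP.≟ 0ℤ)

x+y≡0∧x≡0⇒y≡0 : ∀ {x y} → x + y ≡ 0ℤ → x ≡ 0ℤ → y ≡ 0ℤ
x+y≡0∧x≡0⇒y≡0 {y = y} x+y≡0 refl = trans (sym (ℤP.+-identityˡ y)) x+y≡0

x+y≡0∧y≡0⇒x≡0 : ∀ {x y} → x + y ≡ 0ℤ → y ≡ 0ℤ → x ≡ 0ℤ
x+y≡0∧y≡0⇒x≡0 {x} x+y≡0 refl = trans (sym (ℤP.+-identityʳ x)) x+y≡0

arrival-at-zero : ∀ {h} → UnitSteps h → ∀ m → h 0 + h m ≡ 0ℤ → Moves h m →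
          ∃ λ t → t < m × h t ≢ 0ℤ × h (suc t) ≡ 0ℤ
arrival-at-zero {h} steps m sum≡0 (i , i<m , moves) with h 0 ℤP.≟ 0ℤ
... | yes h₀≡0 with nonzero-near-step h moves
...   | j , j≤1+i , hⱼ≢0 =
  arrival-between h (ℕP.≤-trans j≤1+i i<m) hⱼ≢0 (x+y≡0∧x≡0⇒y≡0 sum≡0 h₀≡0)
arrival-at-zero {h} steps m sum≡0 _ | no h₀≢0 with root-of-trit-sum h steps m (inj₂ (inj₁ sum≡0))
...   | s , s≤m , hₛ≡0 with arrival-between h z≤n h₀≢0 hₛ≡0
...     | t , t<s , arrives = t , ℕP.<-≤-trans t<s s≤m , arrives

departure-at-zero : ∀ {h} → UnitSteps h → ∀ m → h 0 + h m ≡ 0ℤ → Moves h m →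
            ∃ λ t → t < m × h t ≡ 0ℤ × h (suc t) ≢ 0ℤ
departure-at-zero {h} steps m sum≡0 (i , i<m , moves) with h m ℤP.≟ 0ℤ
... | yes hₘ≡0 with nonzero-near-step h moves
...   | j , j≤1+i , hⱼ≢0 with departure-between h z≤n (x+y≡0∧y≡0⇒x≡0 sum≡0 hₘ≡0) hⱼ≢0
...     | t , t<j , departs = t , ℕP.<-≤-trans t<j (ℕP.≤-trans j≤1+i i<m) , departs
departure-at-zero {h} steps m sum≡0 _ | no hₘ≢0 with root-of-trit-sum h steps m (inj₂ (inj₁ sum≡0))
...   | s , s≤m , hₛ≡0 = departure-between h s≤m hₛ≡0 hₘ≢0

minus-cancelʳ : ∀ κ {x y} → x - κ ≡ y - κ → x ≡ y
minus-cancelʳ κ {x} {y} eq = begin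
  x             ≡⟨ restore x κ ⟩
  (x - κ) + κ   ≡⟨ cong (_+ κ) eq ⟩
  (y - κ) + κ   ≡⟨ restore y κ ⟨
  y             ∎
  where
  open ≡-Reasoning
  restore : ∀ x κ → x ≡ (x - κ) + κ
  restore = solve-∀

shift-sum : ∀ {x y} κ → x + y ≡ κ + κ → (x - κ) + (y - κ) ≡ 0ℤ
shift-sum {x} {y} κ x+y≡2κ = trans (regroup x y κ) (ℤP.i≡j⇒i-j≡0 x+y≡2κ)
  where
  regroup : ∀ x y κ → (x - κ) + (y - κ) ≡ (x + y) - (κ + κ)
  regroup = solve-∀

arrival-at : ∀ {f κ} → UnitSteps f → ∀ m → f 0 + f m ≡ κ + κ → Moves f m →
             ∃ λ (t : Fin m) → f (toℕ t) ≢ κ × f (suc (toℕ t)) ≡ κ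
arrival-at {f} {κ} steps m sum≡2κ (i , i<m , moves)
  with arrival-at-zero {λ t → f t - κ} (unitSteps-shift {f} κ steps) m
         (shift-sum {f 0} {f m} κ sum≡2κ) (i , i<m , moves ∘ minus-cancelʳ κ)
... | t , t<m , fₜ≢κ , fₜ₊₁≡κ = fin-witness {Q = λ t → f t ≢ κ × f (suc t) ≡ κ} t<m
  (fₜ≢κ ∘ ℤP.i≡j⇒i-j≡0 , ℤP.i-j≡0⇒i≡j _ _ fₜ₊₁≡κ)

departure-at : ∀ {f κ} → UnitSteps f → ∀ m → f 0 + f m ≡ κ + κ → Moves f m →
               ∃ λ (t : Fin m) → f (toℕ t) ≡ κ × f (suc (toℕ t)) ≢ κ
departure-at {f} {κ} steps m sum≡2κ (i , i<m , moves)
  with departure-at-zero {λ t → f t - κ} (unitSteps-shift {f} κ steps) m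
         (shift-sum {f 0} {f m} κ sum≡2κ) (i , i<m , moves ∘ minus-cancelʳ κ)
... | t , t<m , fₜ≡κ , fₜ₊₁≢κ = fin-witness {Q = λ t → f t ≡ κ × f (suc t) ≢ κ} t<m
  (ℤP.i-j≡0⇒i≡j _ _ fₜ≡κ , fₜ₊₁≢κ ∘ ℤP.i≡j⇒i-j≡0)

-- Alternating sums

-- altSum A t = Σ_{i < t} (-1)^i A i, the sum being truncated at the length of A.
altSum : ∀ {n} → Vecℤ n → ℕ → ℤ
altSum         A zero    = 0ℤ
altSum {zero}  A (suc t) = 0ℤ
altSum {suc n} A (suc t) = head A - altSum (tail A) t

altSum-step : ∀ {n} (A : Vecℤ n) (t : Fin n) →
              altSum A (suc (toℕ t)) ≡ altSum A (toℕ t) + sign (toℕ t) * A t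
altSum-step A zero    = first (head A)
  where
  first : ∀ a → a - 0ℤ ≡ 0ℤ + 1ℤ * a
  first = solve-∀
altSum-step A (suc t) rewrite altSum-step (tail A) t =
  next (head A) (altSum (tail A) (toℕ t)) (sign (toℕ t)) (A (suc t))
  where
  next : ∀ a x s b → a - (x + s * b) ≡ (a - x) + (- s) * b
  next = solve-∀

altSum-stationary : ∀ {n} (A : Vecℤ n) (i : Fin n) → A i ≡ 0ℤ →
                    altSum A (suc (toℕ i)) ≡ altSum A (toℕ i)
altSum-stationary A i Aᵢ≡0 = begin
  altSum A (suc (toℕ i))        ≡⟨ altSum-step A i ⟩
  x + sign (toℕ i) * A i        ≡⟨ cong (λ a → x + sign (toℕ i) * a) Aᵢ≡0 ⟩
  x + sign (toℕ i) * 0ℤ         ≡⟨ vanish x (sign (toℕ i)) ⟩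
  x                             ∎
  where
  open ≡-Reasoning
  x = altSum A (toℕ i)
  vanish : ∀ x s → x + s * 0ℤ ≡ x
  vanish = solve-∀

altSum-moves : ∀ {n} (A : Vecℤ n) (i : Fin n) → A i ≢ 0ℤ → Moves (altSum A) n
altSum-moves A i Aᵢ≢0 = toℕ i , FinP.toℕ<n i , λ stays → [ sign≢0 (toℕ i) , Aᵢ≢0 ]′
  (ℤP.i*j≡0⇒i≡0∨j≡0 (sign (toℕ i)) (increment≡0 (trans (sym (altSum-step A i)) stays)))
  where
  increment≡0 : ∀ {x δ} → x + δ ≡ x → δ ≡ 0ℤ
  increment≡0 {x} {δ} x+δ≡x = trans (isolate x δ) (ℤP.i≡j⇒i-j≡0 x+δ≡x)
    where
    isolate : ∀ x δ → δ ≡ (x + δ) - x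
    isolate = solve-∀

altSum-unitSteps : ∀ {n} {A : Vecℤ n} → Signed A → UnitSteps (altSum A)
altSum-unitSteps {zero} _ zero    = 0ℤ , inj₂ (inj₁ refl) , refl
altSum-unitSteps {zero} _ (suc t) = 0ℤ , inj₂ (inj₁ refl) , refl
altSum-unitSteps {suc n} {A} signed zero = head A , signed zero , first (head A)
  where
  first : ∀ a → a - 0ℤ ≡ 0ℤ + a
  first = solve-∀
altSum-unitSteps {suc n} {A} signed (suc t) with altSum-unitSteps (signed ∘ suc) t
... | δ , δ-trit , step rewrite step =
  - δ , trit-neg δ-trit , next (head A) (altSum (tail A) t) δ
  where
  next : ∀ a x δ → a - (x + δ) ≡ (a - x) + - δ
  next = solve-∀

altSum-minus : ∀ {n} (A B : Vecℤ n) t → altSum (λ i → A i - B i) t ≡ altSum A t - altSum B t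
altSum-minus         A B zero    = refl
altSum-minus {zero}  A B (suc t) = refl
altSum-minus {suc n} A B (suc t) rewrite altSum-minus (tail A) (tail B) t =
  regroup (head A) (head B) (altSum (tail A) t) (altSum (tail B) t)
  where
  regroup : ∀ a b x y → (a - b) - (x - y) ≡ (a - x) - (b - y)
  regroup = solve-∀

altSum-onesVec : ∀ {n t} → t ≤ n → altSum {n} onesVec t + altSum onesVec t ≡ 1ℤ - sign t
altSum-onesVec {t = zero} _ = refl
altSum-onesVec {suc n} {suc t} (s≤s t≤n) = begin
  (1ℤ - x) + (1ℤ - x)     ≡⟨ regroup x ⟩
  (1ℤ + 1ℤ) - (x + x)     ≡⟨ cong (λ y → (1ℤ + 1ℤ) - y) (altSum-onesVec t≤n) ⟩
  (1ℤ + 1ℤ) - (1ℤ - s)    ≡⟨ simplify s ⟩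
  1ℤ - - s                ∎
  where
  open ≡-Reasoning
  x = altSum {n} onesVec t
  s = sign t
  regroup : ∀ x → (1ℤ - x) + (1ℤ - x) ≡ (1ℤ + 1ℤ) - (x + x)
  regroup = solve-∀
  simplify : ∀ s → (1ℤ + 1ℤ) - (1ℤ - s) ≡ 1ℤ - - s
  simplify = solve-∀

altSum-onesVec-odd : ∀ {k} → sign k ≡ 1ℤ → altSum {suc k} onesVec (suc k) ≡ 1ℤ
altSum-onesVec-odd {k} sign≡1 = ℤP.*-cancelˡ-≡ (+ 2) _ 1ℤ (begin
  + 2 * o                 ≡⟨ double o ⟩
  o + o                   ≡⟨ altSum-onesVec {suc k} {suc k} ℕP.≤-refl ⟩
  1ℤ - - sign k           ≡⟨ cong (λ s → 1ℤ - - s) sign≡1 ⟩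
  + 2 * 1ℤ                ∎)
  where
  open ≡-Reasoning
  o = altSum {suc k} onesVec (suc k)
  double : ∀ o → + 2 * o ≡ o + o
  double = solve-∀

altSum-first-bit : ∀ {n} {A : Vecℤ n} → Binary A → Bit (altSum A 1)
altSum-first-bit {zero}  _ = inj₁ refl
altSum-first-bit {suc n} {A} binary with binary zero
... | inj₁ A₀≡0 rewrite A₀≡0 = inj₁ refl
... | inj₂ A₀≡1 rewrite A₀≡1 = inj₂ refl

altSum-twoSteps : ∀ {n} {A : Vecℤ n} → Binary A → ∀ t →
                  ∃ λ δ → Trit δ × altSum A (suc (suc t)) ≡ altSum A t + δ
altSum-twoSteps {zero} _ zero    = 0ℤ , inj₂ (inj₁ refl) , refl
altSum-twoSteps {zero} _ (suc t) = 0ℤ , inj₂ (inj₁ refl) , refl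
altSum-twoSteps {suc n} {A} binary zero =
  head A - altSum (tail A) 1 , bit-difference (binary zero) (altSum-first-bit (binary ∘ suc)) ,
  sym (ℤP.+-identityˡ _)
altSum-twoSteps {suc n} {A} binary (suc t) with altSum-twoSteps (binary ∘ suc) t
... | δ , δ-trit , step rewrite step =
  - δ , trit-neg δ-trit , next (head A) (altSum (tail A) t) δ
  where
  next : ∀ a x δ → a - (x + δ) ≡ (a - x) + - δ
  next = solve-∀

altSum-last : ∀ {k} → sign k ≡ 1ℤ → (A : Vecℤ (suc k)) →
              altSum A (suc k) ≡ altSum A k + A (fromℕ k)
altSum-last {k} sign≡1 A with altSum-step A (fromℕ k)
... | step rewrite FinP.toℕ-fromℕ k | sign≡1 =
  trans step (cong (_+_ (altSum A k)) (ℤP.*-identityˡ _))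

alternating : ∀ {n} → ℤ → Vecℤ n
alternating s zero    = s
alternating s (suc i) = alternating (- s) i

withHole : ∀ {n} → ℤ → Fin n → Vecℤ n
withHole s zero    = 0ℤ ∷ alternating s
withHole s (suc t) = s ∷ withHole (- s) t

gapSum : ∀ {n} → Vecℤ n → ℕ → ℤ
gapSum {n} A t = altSum A t + altSum A (suc t) - altSum A n

dot-alternating : ∀ {n} s (A : Vecℤ n) → dot (alternating s) A ≡ s * altSum A n
dot-alternating {zero}  s A = sym (ℤP.*-zeroʳ s)
dot-alternating {suc n} s A rewrite dot-alternating (- s) (tail A) =
  factor s (head A) (altSum (tail A) n)
  where
  factor : ∀ s a x → s * a + (- s) * x ≡ s * (a - x)
  factor = solve-∀

dot-withHole : ∀ {n} s (t : Fin n) (A : Vecℤ n) → dot (withHole s t) A ≡ s * gapSum A (toℕ t)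
dot-withHole {suc n} s zero A rewrite dot-alternating s (tail A) =
  factor s (head A) (altSum (tail A) n)
  where
  factor : ∀ s a x → 0ℤ * a + s * x ≡ s * (0ℤ + (a - 0ℤ) - (a - x))
  factor = solve-∀
dot-withHole {suc n} s (suc t) A rewrite dot-withHole (- s) t (tail A) =
  factor s (head A) (altSum (tail A) (toℕ t)) (altSum (tail A) (suc (toℕ t))) (altSum (tail A) n)
  where
  factor : ∀ s a x y z → s * a + (- s) * (x + y - z) ≡ s * ((a - x) + (a - y) - (a - z))
  factor = solve-∀

gapSum-unitSteps : ∀ {n} {A : Vecℤ n} → Binary A → UnitSteps (gapSum A)
gapSum-unitSteps {n} {A} binary t with altSum-twoSteps binary t
... | δ , δ-trit , step rewrite step =
  δ , δ-trit , regroup (altSum A t) (altSum A (suc t)) δ (altSum A n)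
  where
  regroup : ∀ x y δ c → y + (x + δ) - c ≡ (x + y - c) + δ
  regroup = solve-∀

gapSum-root : ∀ {k} → sign k ≡ 1ℤ → (A : Vecℤ (suc k)) → Binary A →
              ∃ λ (t : Fin (suc k)) → gapSum A (toℕ t) ≡ 0ℤ
gapSum-root {k} sign≡1 A binary
  with root-of-trit-sum (gapSum A) (gapSum-unitSteps binary) k
         (subst Trit (sym ends) (bit-difference (altSum-first-bit binary) (binary (fromℕ k))))
  where
  ends : gapSum A 0 + gapSum A k ≡ altSum A 1 - A (fromℕ k)
  ends rewrite altSum-last sign≡1 A = telescope (altSum A 1) (altSum A k) (A (fromℕ k))
    where
    telescope : ∀ a₁ x a → (0ℤ + a₁ - (x + a)) + (x + (x + a) - (x + a)) ≡ a₁ - a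
    telescope = solve-∀
... | t , t≤k , root = fin-witness (s≤s t≤k) root

gapSum-at-arrival : ∀ {n κ} (A : Vecℤ n) → Binary A → (t : Fin n) →
                    altSum A (toℕ t) ≢ κ → altSum A (suc (toℕ t)) ≡ κ → altSum A n ≡ κ + κ →
                    gapSum A (toℕ t) ≡ - sign (toℕ t)
gapSum-at-arrival {n} A binary t x≢κ y≡κ total≡2κ with binary t
... | inj₁ Aₜ≡0 = contradiction (trans (sym (altSum-stationary A t Aₜ≡0)) y≡κ) x≢κ
... | inj₂ Aₜ≡1 = begin
  x + y - altSum A n         ≡⟨ cong (λ c → x + y - c) (trans total≡2κ (sym (cong₂ _+_ y≡κ y≡κ))) ⟩
  x + y - (y + y)            ≡⟨ cancel x y ⟩
  x - y                      ≡⟨ cong (_-_ x) (trans (altSum-step A t) (cong (λ a → x + s * a) Aₜ≡1)) ⟩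
  x - (x + s * 1ℤ)           ≡⟨ cancel′ x s ⟩
  - s                        ∎
  where
  open ≡-Reasoning
  x = altSum A (toℕ t)
  y = altSum A (suc (toℕ t))
  s = sign (toℕ t)
  cancel : ∀ x y → x + y - (y + y) ≡ x - y
  cancel = solve-∀
  cancel′ : ∀ x s → x - (x + s * 1ℤ) ≡ - s
  cancel′ = solve-∀

gapSum-at-departure : ∀ {n κ} (A : Vecℤ n) → Binary A → (t : Fin n) →
                      altSum (λ i → A i - 1ℤ) (toℕ t) ≡ κ →
                      altSum (λ i → A i - 1ℤ) (suc (toℕ t)) ≢ κ →
                      altSum A n ≡ 1ℤ + (κ + κ) →
                      gapSum A (toℕ t) ≡ - sign (toℕ t)
gapSum-at-departure {n} {κ} A binary t fₜ≡κ fₜ₊₁≢κ total≡1+2κ with binary t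
... | inj₂ Aₜ≡1 = contradiction
  (trans (altSum-stationary (λ i → A i - 1ℤ) t (cong (_- 1ℤ) Aₜ≡1)) fₜ≡κ) fₜ₊₁≢κ
... | inj₁ Aₜ≡0 = begin
  x + altSum A (suc (toℕ t)) - altSum A n
    ≡⟨ cong₂ (λ y c → x + y - c) (altSum-stationary A t Aₜ≡0) total≡1+2κ ⟩
  x + x - (1ℤ + (κ + κ))
    ≡⟨ cong (λ κ → x + x - (1ℤ + (κ + κ))) κ≡x-o ⟩
  x + x - (1ℤ + ((x - o) + (x - o)))
    ≡⟨ cancel x o ⟩
  (o + o) - 1ℤ
    ≡⟨ cong (_- 1ℤ) (altSum-onesVec (ℕP.<⇒≤ (FinP.toℕ<n t))) ⟩
  (1ℤ - s) - 1ℤ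
    ≡⟨ cancel′ s ⟩
  - s ∎
  where
  open ≡-Reasoning
  x = altSum A (toℕ t)
  o = altSum {n} onesVec (toℕ t)
  s = sign (toℕ t)
  κ≡x-o : κ ≡ x - o
  κ≡x-o = trans (sym fₜ≡κ) (altSum-minus A onesVec (toℕ t))
  cancel : ∀ x o → x + x - (1ℤ + ((x - o) + (x - o))) ≡ (o + o) - 1ℤ
  cancel = solve-∀
  cancel′ : ∀ s → (1ℤ - s) - 1ℤ ≡ - s
  cancel′ = solve-∀

gapSum-antiSign-evenTotal : ∀ {k κ} (A : Vecℤ (suc k)) → Binary A → (∃ λ i → A i ≡ 1ℤ) →
                            altSum A (suc k) ≡ κ + κ →
                            ∃ λ (t : Fin (suc k)) → gapSum A (toℕ t) ≡ - sign (toℕ t)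
gapSum-antiSign-evenTotal {k} {κ} A binary (i , Aᵢ≡1) total≡2κ =
  Product.map₂ (λ {t} (fₜ≢κ , fₜ₊₁≡κ) → gapSum-at-arrival A binary t fₜ≢κ fₜ₊₁≡κ total≡2κ)
    (arrival-at {altSum A} {κ} (altSum-unitSteps (binary⇒signed binary)) (suc k)
      (trans (ℤP.+-identityˡ (altSum A (suc k))) total≡2κ)
      (altSum-moves A i λ Aᵢ≡0 → isSign⇒≢0 (inj₂ refl) (trans (sym Aᵢ≡1) Aᵢ≡0)))

-- With an odd total, the alternating sum of A - 1 has even total; a departure of it from its
-- half-total lands on a coordinate where A vanishes.
gapSum-antiSign-oddTotal : ∀ {k κ} → sign k ≡ 1ℤ → (A : Vecℤ (suc k)) → Binary A →
                           (∃ λ j → A j ≡ 0ℤ) → altSum A (suc k) ≡ 1ℤ + (κ + κ) →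
                           ∃ λ (t : Fin (suc k)) → gapSum A (toℕ t) ≡ - sign (toℕ t)
gapSum-antiSign-oddTotal {k} {κ} sign≡1 A binary (j , Aⱼ≡0) total≡1+2κ =
  Product.map₂ (λ {t} (fₜ≡κ , fₜ₊₁≢κ) → gapSum-at-departure A binary t fₜ≡κ fₜ₊₁≢κ total≡1+2κ)
    (departure-at {altSum A′} {κ} (altSum-unitSteps (λ i → bit-difference (binary i) (inj₂ refl)))
      (suc k) ends
      (altSum-moves A′ j λ A′ⱼ≡0 → isSign⇒≢0 (inj₁ refl) (trans (cong (_- 1ℤ) (sym Aⱼ≡0)) A′ⱼ≡0)))
  where
  A′ : Vecℤ (suc k)
  A′ i = A i - 1ℤ
  ends : 0ℤ + altSum A′ (suc k) ≡ κ + κ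
  ends = begin
    0ℤ + altSum A′ (suc k)                      ≡⟨ ℤP.+-identityˡ _ ⟩
    altSum A′ (suc k)                           ≡⟨ altSum-minus A onesVec (suc k) ⟩
    altSum A (suc k) - altSum onesVec (suc k)
      ≡⟨ cong₂ _-_ total≡1+2κ (altSum-onesVec-odd {k} sign≡1) ⟩
    1ℤ + (κ + κ) - 1ℤ                           ≡⟨ cancel κ ⟩
    κ + κ                                       ∎
    where
    open ≡-Reasoning
    cancel : ∀ κ → 1ℤ + (κ + κ) - 1ℤ ≡ κ + κ
    cancel = solve-∀

gapSum-antiSign : ∀ {k} → sign k ≡ 1ℤ → (A : Vecℤ (suc k)) → Binary A →
                  (∃ λ i → A i ≡ 1ℤ) → (∃ λ j → A j ≡ 0ℤ) →
                  ∃ λ (t : Fin (suc k)) → gapSum A (toℕ t) ≡ - sign (toℕ t)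
gapSum-antiSign {k} sign≡1 A binary has-one has-zero with halve (altSum A (suc k))
... | κ , inj₁ total≡2κ   = gapSum-antiSign-evenTotal {κ = κ} A binary has-one total≡2κ
... | κ , inj₂ total≡1+2κ = gapSum-antiSign-oddTotal {κ = κ} sign≡1 A binary has-zero total≡1+2κ

-- The covering families

alternating-isSign : ∀ {n s} → IsSign s → (i : Fin n) → IsSign (alternating s i)
alternating-isSign s±1 zero    = s±1
alternating-isSign s±1 (suc i) = alternating-isSign (isSign-neg s±1) i

withHole-signed : ∀ {n s} → IsSign s → (t : Fin n) → Signed (withHole s t)
withHole-signed s±1 zero    zero    = inj₂ (inj₁ refl)
withHole-signed s±1 zero    (suc i) = isSign⇒trit (alternating-isSign s±1 i)
withHole-signed s±1 (suc t) zero    = isSign⇒trit s±1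
withHole-signed s±1 (suc t) (suc i) = withHole-signed (isSign-neg s±1) t i

withHole-nonzero : ∀ {n s} → IsSign s → {t i : Fin n} → i ≢ t → withHole s t i ≢ 0ℤ
withHole-nonzero s±1 {zero}  {zero}  i≢t = contradiction refl i≢t
withHole-nonzero s±1 {zero}  {suc i} _   = isSign⇒≢0 (alternating-isSign s±1 i)
withHole-nonzero s±1 {suc t} {zero}  _   = isSign⇒≢0 s±1
withHole-nonzero s±1 {suc t} {suc i} i≢t = withHole-nonzero (isSign-neg s±1) (i≢t ∘ cong suc)

nnz-alternating : ∀ {n s} → IsSign s → nnz {n} (alternating s) ≡ n
nnz-alternating {zero}  s±1 = refl
nnz-alternating {suc n} s±1 =
  trans (nnz-head-nonzero (alternating _) (isSign⇒≢0 s±1))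
        (cong suc (nnz-alternating (isSign-neg s±1)))

nnz-withHole : ∀ {n s} → IsSign s → (t : Fin (suc n)) → nnz (withHole s t) ≡ n
nnz-withHole {n} {s} s±1 zero    =
  trans (nnz-head-zero (withHole {suc n} s zero) refl) (nnz-alternating {n} s±1)
nnz-withHole {suc n} {s} s±1 (suc t) =
  trans (nnz-head-nonzero (withHole s (suc t)) (isSign⇒≢0 s±1))
        (cong suc (nnz-withHole (isSign-neg s±1) t))

evenFamily : ∀ k → List (Vecℤ (suc k))
evenFamily k = tabulate (withHole 1ℤ)

oddMember : ∀ {k} → Fin (suc k) → Vecℤ (suc (suc k))
oddMember t = sign (toℕ t) ∷ withHole 1ℤ t

oddFamily : ∀ k → List (Vecℤ (suc (suc k)))
oddFamily k = tabulate oddMember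

evenFamily-cover : ∀ {k} → sign k ≡ 1ℤ → IsCover k (suc k) (evenFamily k)
evenFamily-cover {k} sign≡1 =
  AllP.tabulate⁺ {f = withHole 1ℤ}
    (λ t → withHole-signed (inj₂ refl) t , nnz-withHole (inj₂ refl) t)
  , covers
  where
  covers : ∀ A → Binary A → ¬ Trivial k A → Any (λ V → NonTriviallyOrthogonal V A) (evenFamily k)
  covers A binary nontrivial with gapSum-root sign≡1 A binary
  ... | t , root with nontrivial⇒one-elsewhere k binary nontrivial t
  ...   | i , i≢t , Aᵢ≡1 = AnyP.tabulate⁺ {f = withHole 1ℤ} t
    ( trans (dot-withHole 1ℤ t A) (cong (1ℤ *_) root)
    , ¬trivially-orthogonal i (withHole-nonzero (inj₂ refl) i≢t) Aᵢ≡1 )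

oddFamily-signed : ∀ {k} (t : Fin (suc k)) → Signed (oddMember t)
oddFamily-signed t zero    = isSign⇒trit (sign-isSign (toℕ t))
oddFamily-signed t (suc i) = withHole-signed (inj₂ refl) t i

oddFamily-nnz : ∀ {k} (t : Fin (suc k)) → nnz (oddMember t) ≡ suc k
oddFamily-nnz t = trans (nnz-head-nonzero (oddMember t) (sign≢0 (toℕ t)))
                        (cong suc (nnz-withHole (inj₂ refl) t))

dot-oddMember : ∀ {k} (t : Fin (suc k)) (A : Vecℤ (suc (suc k))) →
                dot (oddMember t) A ≡ sign (toℕ t) * head A + gapSum (tail A) (toℕ t)
dot-oddMember t A =
  cong (_+_ (sign (toℕ t) * head A)) (trans (dot-withHole 1ℤ t (tail A)) (ℤP.*-identityˡ _))

oddFamily-cover : ∀ m → IsCover (suc (m ℕ.+ m)) (suc (suc (m ℕ.+ m))) (oddFamily (m ℕ.+ m))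
oddFamily-cover m =
  AllP.tabulate⁺ {f = oddMember} (λ t → oddFamily-signed t , oddFamily-nnz t) , covers
  where
  k = m ℕ.+ m
  Orthogonal : Vecℤ (suc (suc k)) → Set
  Orthogonal A = Any (λ V → NonTriviallyOrthogonal V A) (oddFamily k)

  covers-head-zero : ∀ A → Binary A → ¬ Trivial (suc k) A → head A ≡ 0ℤ → Orthogonal A
  covers-head-zero A binary nontrivial A₀≡0 with gapSum-root (sign-double m) (tail A) (binary ∘ suc)
  ... | t , root with nontrivial⇒one-elsewhere (suc k) binary nontrivial (suc t)
  ...   | zero  , _    , A₀≡1 = contradiction (trans (sym A₀≡0) A₀≡1) λ ()
  ...   | suc i , i≢t , Aᵢ≡1 = AnyP.tabulate⁺ {f = oddMember} t
    ( trans (dot-oddMember t A) (trans (cong₂ (λ a b → sign (toℕ t) * a + b) A₀≡0 root)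
                                       (cong (_+ 0ℤ) (ℤP.*-zeroʳ (sign (toℕ t)))))
    , ¬trivially-orthogonal (suc i) (withHole-nonzero (inj₂ refl) (i≢t ∘ cong suc)) Aᵢ≡1 )

  covers-head-one : ∀ A → Binary A → ¬ Trivial (suc k) A → head A ≡ 1ℤ → Orthogonal A
  covers-head-one A binary nontrivial A₀≡1
    with nontrivial⇒one-elsewhere (suc k) binary nontrivial zero
  ... | zero  , 0≢0 , _    = contradiction refl 0≢0
  ... | suc i , _   , Aᵢ≡1 with gapSum-antiSign (sign-double m) (tail A) (binary ∘ suc) (i , Aᵢ≡1)
                                (binary-not-ones⇒zero (binary ∘ suc) not-ones)
    where
    not-ones : ¬ (∀ i → tail A i ≡ 1ℤ)
    not-ones tail-ones =
      nontrivial (inj₂ (inj₂ (odd-%2 m , λ { zero → A₀≡1 ; (suc i) → tail-ones i })))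
  ...   | t , antiSign = AnyP.tabulate⁺ {f = oddMember} t
    ( trans (dot-oddMember t A) (trans (cong₂ (λ a b → sign (toℕ t) * a + b) A₀≡1 antiSign)
                                       (cancel (sign (toℕ t))))
    , ¬trivially-orthogonal zero (sign≢0 (toℕ t)) A₀≡1 )
    where
    cancel : ∀ s → s * 1ℤ + (- s) ≡ 0ℤ
    cancel = solve-∀

  covers : ∀ A → Binary A → ¬ Trivial (suc k) A → Orthogonal A
  covers A binary nontrivial =
    [ covers-head-zero A binary nontrivial , covers-head-one A binary nontrivial ]′ (binary zero)

-- Lower bounds

allOnesExcept : ∀ {n} → Fin n → Vecℤ n
allOnesExcept w i = 1ℤ - unit w i

allOnesExcept₂ : ∀ {n} → Fin n → Fin n → Vecℤ n
allOnesExcept₂ w u i = allOnesExcept w i - unit u i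

allOnesExcept-binary : ∀ {n} (w : Fin n) → Binary (allOnesExcept w)
allOnesExcept-binary w i with unit-binary w i
... | inj₁ eᵢ≡0 rewrite eᵢ≡0 = inj₂ refl
... | inj₂ eᵢ≡1 rewrite eᵢ≡1 = inj₁ refl

allOnesExcept₂-binary : ∀ {n} {w u : Fin n} → w ≢ u → Binary (allOnesExcept₂ w u)
allOnesExcept₂-binary {w = w} {u} w≢u i = by-cases (i Fin.≟ w) (i Fin.≟ u)
  where
  by-cases : Dec (i ≡ w) → Dec (i ≡ u) → Bit (allOnesExcept₂ w u i)
  by-cases (yes refl) _
    rewrite unit-diagonal i | unit-off-diagonal w≢u = inj₁ refl
  by-cases (no i≢w) (yes refl)
    rewrite unit-diagonal i | unit-off-diagonal i≢w = inj₁ refl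
  by-cases (no i≢w) (no i≢u)
    rewrite unit-off-diagonal i≢w | unit-off-diagonal i≢u = inj₂ refl

dot-allOnesExcept : ∀ {n} (V : Vecℤ n) w → dot V (allOnesExcept w) ≡ dot V onesVec - V w
dot-allOnesExcept V w =
  trans (dot-minusʳ V onesVec (unit w)) (cong (_-_ (dot V onesVec)) (dot-unitʳ V w))

dot-allOnesExcept₂ : ∀ {n} (V : Vecℤ n) w u → dot V (allOnesExcept₂ w u) ≡ dot V onesVec - V w - V u
dot-allOnesExcept₂ V w u =
  trans (dot-minusʳ V (allOnesExcept w) (unit u))
        (cong₂ _-_ (dot-allOnesExcept V w) (dot-unitʳ V u))

allOnesExcept-nontrivial : ∀ {n} d (w : Fin n) → 3 ≤ n → ¬ Trivial d (allOnesExcept w)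
allOnesExcept-nontrivial {n} d w (s≤s (s≤s (s≤s _))) =
  ¬trivial-by-total d (trans (dot-allOnesExcept onesVec w) (cong (_- 1ℤ) (dot-onesVec-onesVec n)))
    (λ ()) (λ ()) (λ ())

allOnesExcept₂-nontrivial : ∀ {n} d (w u : Fin n) → 4 ≤ n → ¬ Trivial d (allOnesExcept₂ w u)
allOnesExcept₂-nontrivial {n} d w u (s≤s (s≤s (s≤s (s≤s _)))) =
  ¬trivial-by-total d
    (trans (dot-allOnesExcept₂ onesVec w u) (cong (λ x → x - 1ℤ - 1ℤ) (dot-onesVec-onesVec n)))
    (λ ()) (λ ()) (λ ())

even-support-orthogonal⇒zero : ∀ {n m} (V : Vecℤ n) → Signed V → nnz V ≡ m ℕ.+ m →
                               ∀ w → dot V (allOnesExcept w) ≡ 0ℤ → V w ≡ 0ℤ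
even-support-orthogonal⇒zero {m = m} V signed nnz≡2m w orthogonal with signed-sum-parity V signed
... | j , sum≡ = trit-even⇒0 {j = + m + j} (signed w) (begin
  V w                      ≡⟨ ℤP.i-j≡0⇒i≡j _ _ (trans (sym (dot-allOnesExcept V w)) orthogonal) ⟨
  dot V onesVec            ≡⟨ sum≡ ⟩
  + nnz V + (j + j)        ≡⟨ cong (λ k → + k + (j + j)) nnz≡2m ⟩
  + (m ℕ.+ m) + (j + j)    ≡⟨ cong (_+ (j + j)) (ℤP.pos-+ m m) ⟩
  (+ m + + m) + (j + j)    ≡⟨ regroup (+ m) j ⟩
  (+ m + j) + (+ m + j)    ∎)
  where
  open ≡-Reasoning
  regroup : ∀ x j → (x + x) + (j + j) ≡ (x + j) + (x + j)
  regroup = solve-∀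

odd-support-orthogonal⇒zero : ∀ {n m} (V : Vecℤ n) → Signed V → nnz V ≡ suc (m ℕ.+ m) →
                              ∀ w u → dot V (allOnesExcept₂ w u) ≡ 0ℤ → V w ≡ 0ℤ ⊎ V u ≡ 0ℤ
odd-support-orthogonal⇒zero {m = m} V signed nnz≡1+2m w u orthogonal with signed-sum-parity V signed
... | j , sum≡ = trit-sum-odd⇒0 {j = + m + j} (signed w) (signed u) (begin
  V w + V u                        ≡⟨ removed (dot V onesVec) (V w) (V u) ⟩
  S - (S - V w - V u)
    ≡⟨ cong (_-_ S) (trans (sym (dot-allOnesExcept₂ V w u)) orthogonal) ⟩
  S - 0ℤ                           ≡⟨ ℤP.+-identityʳ S ⟩
  S                                ≡⟨ sum≡ ⟩
  + nnz V + (j + j)                ≡⟨ cong (λ k → + k + (j + j)) nnz≡1+2m ⟩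
  1ℤ + + (m ℕ.+ m) + (j + j)       ≡⟨ cong (λ x → 1ℤ + x + (j + j)) (ℤP.pos-+ m m) ⟩
  1ℤ + (+ m + + m) + (j + j)       ≡⟨ regroup (+ m) j ⟩
  1ℤ + ((+ m + j) + (+ m + j))     ∎)
  where
  open ≡-Reasoning
  S = dot V onesVec
  removed : ∀ s a b → a + b ≡ s - (s - a - b)
  removed = solve-∀
  regroup : ∀ x j → 1ℤ + (x + x) + (j + j) ≡ 1ℤ + ((x + j) + (x + j))
  regroup = solve-∀

All∧Any⇒Any-× : ∀ {X : Set} {P Q : X → Set} {xs} → All P xs → Any Q xs → Any (λ x → P x × Q x) xs
All∧Any⇒Any-× (px All.∷ _)   (here qx)   = here (px , qx)
All∧Any⇒Any-× (_ All.∷ pxs) (there qxs) = there (All∧Any⇒Any-× pxs qxs)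

-- Each member of the family has a single zero, so distinct coordinates g w need distinct members.
cover-size-from-zeros : ∀ {d k} (𝒱 : List (Vecℤ (suc d))) (g : Fin k → Fin (suc d)) →
                        Injective _≡_ _≡_ g →
                        (∀ w → Any (λ V → nnz V ≡ d × V (g w) ≡ 0ℤ) 𝒱) → k ≤ length 𝒱
cover-size-from-zeros 𝒱 g g-injective zeros = FinP.injective⇒≤ index-injective
  where
  index-injective : Injective _≡_ _≡_ (λ w → index (zeros w))
  index-injective {w} {w′} same-index
    with AnyP.lookup-index (zeros w) | AnyP.lookup-index (zeros w′)
  ... | nnz≡d , zero-at-w | _ , zero-at-w′ = g-injective
    (zero-unique (lookup 𝒱 (index (zeros w))) nnz≡d zero-at-w
      (subst (λ i → lookup 𝒱 i (g w′) ≡ 0ℤ) (sym same-index) zero-at-w′))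

even-cover-zeros : ∀ m {𝒱} → 2 ≤ m ℕ.+ m → IsCover (m ℕ.+ m) (suc (m ℕ.+ m)) 𝒱 →
                   ∀ w → Any (λ V → nnz V ≡ m ℕ.+ m × V w ≡ 0ℤ) 𝒱
even-cover-zeros m 2≤2m (members , covers) w = Any.map
  (λ { {V} ((signed , nnz≡2m) , orthogonal , _) →
         nnz≡2m , even-support-orthogonal⇒zero {m = m} V signed nnz≡2m w orthogonal })
  (All∧Any⇒Any-× members
    (covers (allOnesExcept w) (allOnesExcept-binary w)
            (allOnesExcept-nontrivial (m ℕ.+ m) w (s≤s 2≤2m))))

odd-cover-zeros : ∀ m {𝒱} → 2 ≤ m ℕ.+ m → IsCover (suc (m ℕ.+ m)) (suc (suc (m ℕ.+ m))) 𝒱 →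
                  ∀ {w u} → w ≢ u → ¬ Any (λ V → V u ≡ 0ℤ) 𝒱 →
                  Any (λ V → nnz V ≡ suc (m ℕ.+ m) × V w ≡ 0ℤ) 𝒱
odd-cover-zeros m 2≤2m (members , covers) {w} {u} w≢u no-zero-at-u =
  [ id , (λ zero-at-u → contradiction zero-at-u no-zero-at-u) ]′ (AnyP.Any-⊎⁻ (Any.map
    (λ { {V} ((signed , nnz≡d) , orthogonal , _) →
           Sum.map (nnz≡d ,_) id
             (odd-support-orthogonal⇒zero {m = m} V signed nnz≡d w u orthogonal) })
    (All∧Any⇒Any-× members
      (covers (allOnesExcept₂ w u) (allOnesExcept₂-binary w≢u)
              (allOnesExcept₂-nontrivial (suc (m ℕ.+ m)) w u (s≤s (s≤s 2≤2m)))))))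

even-lower-bound : ∀ m {𝒱} → 2 ≤ m ℕ.+ m → IsCover (m ℕ.+ m) (suc (m ℕ.+ m)) 𝒱 →
                   suc (m ℕ.+ m) ≤ length 𝒱
even-lower-bound m {𝒱} 2≤2m cover = cover-size-from-zeros 𝒱 id id (even-cover-zeros m 2≤2m cover)

odd-lower-bound : ∀ m {𝒱} → 2 ≤ m ℕ.+ m → IsCover (suc (m ℕ.+ m)) (suc (suc (m ℕ.+ m))) 𝒱 →
                  suc (m ℕ.+ m) ≤ length 𝒱
odd-lower-bound m {𝒱} 2≤2m cover@(members , _)
  with FinP.all? (λ u → Any.any? (λ V → V u ℤP.≟ 0ℤ) 𝒱)
... | yes zero-everywhere = ℕP.≤-trans (ℕP.n≤1+n _) (cover-size-from-zeros 𝒱 id id λ u →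
  Any.map (λ { ((_ , nnz≡d) , Vᵤ≡0) → nnz≡d , Vᵤ≡0 }) (All∧Any⇒Any-× members (zero-everywhere u)))
... | no ¬zero-everywhere
  with FinP.¬∀⟶∃¬ _ _ (λ u → Any.any? (λ V → V u ℤP.≟ 0ℤ) 𝒱) ¬zero-everywhere
...   | u , no-zero-at-u = cover-size-from-zeros 𝒱 (punchIn u) (FinP.punchIn-injective u _ _) λ w →
  odd-cover-zeros m 2≤2m cover (FinP.punchInᵢ≢i u w) no-zero-at-u

even-or-odd : ∀ d → ∃ λ m → d ≡ m ℕ.+ m ⊎ d ≡ suc (m ℕ.+ m)
even-or-odd zero = 0 , inj₁ refl
even-or-odd (suc d) with even-or-odd d
... | m , inj₁ d≡2m   = m , inj₂ (cong suc d≡2m)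
... | m , inj₂ d≡1+2m = suc m , inj₁ (trans (cong suc d≡1+2m) (cong suc (sym (ℕP.+-suc m m))))

2≤1+2m⇒2≤2m : ∀ m → 2 ≤ suc (m ℕ.+ m) → 2 ≤ m ℕ.+ m
2≤1+2m⇒2≤2m zero    (s≤s ())
2≤1+2m⇒2≤2m (suc m) _ rewrite ℕP.+-suc m m = s≤s (s≤s z≤n)

theorem3 : (d : ℕ) → 2 ≤ d →
    ∃ λ m → IsBeta d (suc d) m × d ≤ m × m ≤ suc d × (d % 2 ≡ 0 → m ≡ suc d)
theorem3 d 2≤d with even-or-odd d
... | m , inj₁ refl =
  suc d ,
  ( (evenFamily d , evenFamily-cover (sign-double m) , ListP.length-tabulate (withHole 1ℤ))
  , λ _ cover → even-lower-bound m 2≤d cover ) ,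
  ℕP.n≤1+n d , ℕP.≤-refl , λ _ → refl
... | m , inj₂ refl =
  d ,
  ( (oddFamily (m ℕ.+ m) , oddFamily-cover m , ListP.length-tabulate oddMember)
  , λ _ cover → odd-lower-bound m (2≤1+2m⇒2≤2m m 2≤d) cover ) ,
  ℕP.≤-refl , ℕP.n≤1+n d , λ d%2≡0 → contradiction (trans (sym (odd-%2 m)) d%2≡0) λ ()
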